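{- Let $\Lambda_h=\begin{bmatrix}1&-\frac12\\0&\frac{\sqrt3}{2}\end{bmatrix}\mathbb{Z}^2$ and $C_h=\{\theta\in[\pi/3,\pi/2]:\theta=\theta(\Gamma)\text{ for some well-rounded sublattice }\Gamma\subseteq\Lambda_h\}$. Then for each $\theta\in C_h$ there exist exactly two primitive Eisenstein triples, of the form $(a,b,c)$ and $(b-a,b,c)$, such that $$\cos\theta=\frac{|b-2a|}{2c}=\frac{|b-2(b-a)|}{2c}.$$ Conversely, for each primitive Eisenstein triple $(a,b,c)$ there exists a unique $\theta\in C_h$ satisfying this equation.
   Context: For a lattice $\Gamma\subset\mathbb{R}^2$, $|\Gamma|=\min\{\|y\|^2:y\in\Gamma\setminus\{0\}\}$; $\Gamma$ is well-rounded if it has a basis of two vectors attaining this minimum; such a basis can be chosen with angle in $[\pi/3,\pi/2]$ and this angle, independent of the choice, is $\theta(\Gamma)$. An Eisenstein triple is $(a,b,c)\in\mathbb{Z}^3_{\ge0}\setminus\{(0,0,0)\}$ with $a^2-ab+b^2=c^2$; it is primitive if $a\le b$ and $\gcd(a,b,c)=1$. -}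

module Defs where

open import Data.Nat as ℕ using (ℕ; _≤_)
open import Data.Nat.GCD using (gcd)
open import Data.Integer as ℤ using (ℤ; +_; ∣_∣)
open import Data.Rational as ℚ using (ℚ; _/_)
open import Data.Product using (_×_; _,_; Σ; ∃; ∃-syntax)
open import Relation.Binary.PropositionalEquality using (_≡_; _≢_)
open import Relation.Nullary using (¬_)

-- Points of the hexagonal lattice Λ_h = ℤ e₁ ⊕ ℤ ω, with e₁ = (1,0),
-- ω = (-1/2, √3/2), recorded by their integer coordinates (x , y),
-- i.e. the point x e₁ + y ω.
Pt : Set
Pt = ℤ × ℤ

-- squared Euclidean norm: ‖x e₁ + y ω‖² = x² - x y + y²
norm : Pt → ℤ
norm (x , y) = x ℤ.* x ℤ.- x ℤ.* y ℤ.+ y ℤ.* y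

-- twice the Euclidean inner product:
-- 2⟨u , v⟩ = 2 x₁ x₂ - x₁ y₂ - y₁ x₂ + 2 y₁ y₂
ip2 : Pt → Pt → ℤ
ip2 (x₁ , y₁) (x₂ , y₂) =
  + 2 ℤ.* x₁ ℤ.* x₂ ℤ.- x₁ ℤ.* y₂ ℤ.- y₁ ℤ.* x₂ ℤ.+ + 2 ℤ.* y₁ ℤ.* y₂

comb : ℤ → ℤ → Pt → Pt → Pt
comb m n (x₁ , y₁) (x₂ , y₂) = (m ℤ.* x₁ ℤ.+ n ℤ.* x₂ , m ℤ.* y₁ ℤ.+ n ℤ.* y₂)

Indep : Pt → Pt → Set
Indep (x₁ , y₁) (x₂ , y₂) = x₁ ℤ.* y₂ ℤ.- y₁ ℤ.* x₂ ≢ ℤ.0ℤ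

-- (u , v) is a basis of the sublattice Γ = ℤ u + ℤ v ⊆ Λ_h consisting of two
-- vectors attaining |Γ| (so Γ is well-rounded), with angle between u and v
-- in [π/3 , π/2], i.e. 0 ≤ ⟨u , v⟩ ≤ ‖u‖²/2.
WRBasis : Pt → Pt → Set
WRBasis u v =
  Indep u v ×
  norm u ≡ norm v ×
  (∀ (m n : ℤ) → ¬ (m ≡ ℤ.0ℤ × n ≡ ℤ.0ℤ) → norm u ℤ.≤ norm (comb m n u v)) ×
  (ℤ.0ℤ ℤ.≤ ip2 u v) × (ip2 u v ℤ.≤ norm u)

-- IsCosθ q u v : q = cos θ, where θ is the angle between u and v,
-- i.e. q = ⟨u , v⟩ / ‖u‖² = ip2 u v / (2 ‖u‖²)  (written without division).
IsCosθ : ℚ → Pt → Pt → Set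
IsCosθ q u v = q ℚ.* ((+ 2 ℤ.* norm u) / 1) ≡ ip2 u v / 1

-- Angles θ ∈ [π/3 , π/2] are represented by cos θ ∈ [0 , 1/2] (cos is a
-- bijection [π/3 , π/2] → [0 , 1/2]).
InCh : ℚ → Set
InCh q = ∃[ u ] ∃[ v ] (WRBasis u v × IsCosθ q u v)

EisensteinTriple : ℕ → ℕ → ℕ → Set
EisensteinTriple a b c =
  ¬ (a ≡ 0 × b ≡ 0 × c ≡ 0) × (a ℕ.* a ℕ.+ b ℕ.* b ≡ a ℕ.* b ℕ.+ c ℕ.* c)

PrimitiveEisenstein : ℕ → ℕ → ℕ → Set
PrimitiveEisenstein a b c =
  EisensteinTriple a b c × a ≤ b × gcd (gcd a b) c ≡ 1

-- q = |b - 2a| / (2c)  (written without division; c ≥ 1 for any triple)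
CosEq : ℚ → ℕ → ℕ → ℕ → Set
CosEq q a b c = q ℚ.* ((+ (2 ℕ.* c)) / 1) ≡ (+ ∣ + b ℤ.- + 2 ℤ.* + a ∣) / 1

{-# OPTIONS --safe #-}
-- Write N = ‖u‖² = ‖v‖², P = 2⟨u , v⟩ and t = det (u , v) for a well-rounded basis u , v of a
-- sublattice of Λ_h.  Lagrange's identity gives P² + 3t² = (2N)², so (|t| - P , 2|t| , 2N) is an
-- Eisenstein triple with |b - 2a| / 2c = P / 2N = cos θ, and dividing by the gcd makes it
-- primitive.  For any Eisenstein triple (b - 2a)² + 3b² = (2c)², so the cosine determines b / c,
-- and (b - 2a) / c up to sign; changing the sign is the flip a ↦ b - a, which moves every
-- primitive triple because b = 2a would give c² = 3a².  Conversely, for a primitive triple pick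
-- x ∈ {a , b - a} with b ≤ 2x: then u = (c , 0) and v = (x , b) (coordinates in e₁ , ω) satisfy
-- ‖u‖² = ‖v‖² = c² and 0 ≤ 2⟨u , v⟩ = c (2x - b) ≤ c², and such a basis is automatically
-- minimal because m² + n² - |mn| ≥ 1 for (m , n) ≠ 0.

module Submission where

open import Defs
open import Data.Nat as ℕ using (ℕ; zero; suc; _+_; _*_; _∸_; _≤_; _<_; z≤n; s≤s)
import Data.Nat.Properties as ℕP
open import Data.Nat.GCD using (gcd; gcd[m,n]∣m; gcd[m,n]∣n; gcd-greatest; c*gcd[m,n]≡gcd[cm,cn]; gcd[m,n]≢0)
open import Data.Nat.Divisibility using (_∣_; divides; ∣-antisym; ∣-trans; ∣m+n∣m⇒∣n; ∣1⇒≡1; ∣m∣n⇒∣m+n)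
open import Data.Nat.Primality using (Prime; prime?; euclidsLemma)
import Data.Nat.Tactic.RingSolver as ℕSolver
open import Data.Integer as ℤ using (ℤ; +_; ∣_∣)
import Data.Integer.Properties as ℤP
import Data.Integer.GCD as ℤGCD
import Data.Integer.Tactic.RingSolver as ℤSolver
open import Data.Rational as ℚ using (ℚ; mkℚ; _/_; ↥_; ↧_; toℚᵘ)
import Data.Rational.Properties as ℚP
open import Data.Rational.Unnormalised as ℚᵘ using (mkℚᵘ; *≡*)
import Data.Rational.Unnormalised.Properties as ℚᵘP
open import Data.Product using (_×_; _,_; proj₁; proj₂; ∃-syntax)
open import Data.Sum using (_⊎_; inj₁; inj₂; [_,_]′)
import Data.Sum as Sum
open import Function using (id; _∘_; case_of_)
open import Data.Empty using (⊥-elim)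
open import Relation.Nullary using (¬_; yes; no)
open import Relation.Nullary.Decidable using (toWitness)
open import Relation.Binary.PropositionalEquality
import Algebra.Properties.CommutativeSemigroup ℕP.*-commutativeSemigroup as ℕ*
import Algebra.Properties.CommutativeSemigroup ℤP.*-commutativeSemigroup as ℤ*

-- CosEq and IsCosθ are both of this form.
IsRatio : ℚ → ℤ → ℤ → Set
IsRatio q X Y = q ℚ.* (X / 1) ≡ Y / 1

toℚᵘ-*-/1 : ∀ q X → toℚᵘ (q ℚ.* (X / 1)) ℚᵘ.≃ mkℚᵘ (↥ q ℤ.* X) (ℚ.denominator-1 q)
toℚᵘ-*-/1 q@(mkℚ _ _ _) X = ℚᵘP.≃-trans (ℚP.toℚᵘ-homo-* q (X / 1))
  (ℚᵘP.≃-trans (ℚᵘP.*-congˡ {toℚᵘ q} (ℚP.toℚᵘ-fromℚᵘ (mkℚᵘ X 0)))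
    (*≡* (cong (λ d → ↥ q ℤ.* X ℤ.* + suc d) (sym (ℕP.*-identityʳ (ℚ.denominator-1 q))))))

IsRatio⇒cross : ∀ {q X Y} → IsRatio q X Y → ↥ q ℤ.* X ≡ Y ℤ.* ↧ q
IsRatio⇒cross {q} {X} {Y} h with ℚᵘP.≃-trans (ℚᵘP.≃-sym (toℚᵘ-*-/1 q X))
                                  (ℚᵘP.≃-trans (ℚᵘP.≃-reflexive (cong toℚᵘ h)) (ℚP.toℚᵘ-fromℚᵘ (mkℚᵘ Y 0)))
... | *≡* eq = trans (sym (ℤP.*-identityʳ _)) eq

cross⇒IsRatio : ∀ {q X Y} → ↥ q ℤ.* X ≡ Y ℤ.* ↧ q → IsRatio q X Y
cross⇒IsRatio {q} {X} {Y} eq = ℚP.toℚᵘ-injective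
  (ℚᵘP.≃-trans (toℚᵘ-*-/1 q X)
    (ℚᵘP.≃-trans (*≡* (trans (ℤP.*-identityʳ _) eq)) (ℚᵘP.≃-sym (ℚP.toℚᵘ-fromℚᵘ (mkℚᵘ Y 0)))))

IsRatio-cross : ∀ {q X Y X′ Y′} → IsRatio q X Y → IsRatio q X′ Y′ → Y ℤ.* X′ ≡ Y′ ℤ.* X
IsRatio-cross {q} {X} {Y} {X′} {Y′} h h′ = ℤP.*-cancelʳ-≡ _ _ (↧ q) (begin
  Y ℤ.* X′ ℤ.* ↧ q    ≡⟨ ℤ*.xy∙z≈xz∙y Y X′ (↧ q) ⟩
  Y ℤ.* ↧ q ℤ.* X′    ≡⟨ cong (ℤ._* X′) (IsRatio⇒cross {q} {X} {Y} h) ⟨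
  ↥ q ℤ.* X ℤ.* X′    ≡⟨ ℤ*.xy∙z≈xz∙y (↥ q) X X′ ⟩
  ↥ q ℤ.* X′ ℤ.* X    ≡⟨ cong (ℤ._* X) (IsRatio⇒cross {q} {X′} {Y′} h′) ⟩
  Y′ ℤ.* ↧ q ℤ.* X    ≡⟨ ℤ*.xy∙z≈xz∙y Y′ (↧ q) X ⟩
  Y′ ℤ.* X ℤ.* ↧ q    ∎)
  where open ≡-Reasoning

IsRatio-transfer : ∀ {q X Y X′ Y′} → X ≢ ℤ.0ℤ → Y ℤ.* X′ ≡ Y′ ℤ.* X → IsRatio q X Y → IsRatio q X′ Y′
IsRatio-transfer {q} {X} {Y} {X′} {Y′} X≢0 cross h = cross⇒IsRatio {q} {X′} {Y′}
  (ℤP.*-cancelʳ-≡ _ _ X {{ℤ.≢-nonZero X≢0}} (begin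
    ↥ q ℤ.* X′ ℤ.* X    ≡⟨ ℤ*.xy∙z≈xz∙y (↥ q) X X′ ⟨
    ↥ q ℤ.* X ℤ.* X′    ≡⟨ cong (ℤ._* X′) (IsRatio⇒cross {q} {X} {Y} h) ⟩
    Y ℤ.* ↧ q ℤ.* X′    ≡⟨ ℤ*.xy∙z≈xz∙y Y (↧ q) X′ ⟩
    Y ℤ.* X′ ℤ.* ↧ q    ≡⟨ cong (ℤ._* ↧ q) cross ⟩
    Y′ ℤ.* X ℤ.* ↧ q    ≡⟨ ℤ*.xy∙z≈xz∙y Y′ X (↧ q) ⟩
    Y′ ℤ.* ↧ q ℤ.* X    ∎))
  where open ≡-Reasoning

IsRatio-unique : ∀ {q q′ X Y} → X ≢ ℤ.0ℤ → IsRatio q X Y → IsRatio q′ X Y → q ≡ q′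
IsRatio-unique {q} {q′} {X} {Y} X≢0 h h′ =
  ℚP.≃⇒≡ (ℚ.*≡* (ℤP.*-cancelʳ-≡ _ _ X {{ℤ.≢-nonZero X≢0}} (begin
    ↥ q ℤ.* ↧ q′ ℤ.* X    ≡⟨ ℤ*.xy∙z≈xz∙y (↥ q) (↧ q′) X ⟩
    ↥ q ℤ.* X ℤ.* ↧ q′    ≡⟨ cong (ℤ._* ↧ q′) (IsRatio⇒cross {q} {X} {Y} h) ⟩
    Y ℤ.* ↧ q ℤ.* ↧ q′    ≡⟨ ℤ*.xy∙z≈xz∙y Y (↧ q) (↧ q′) ⟩
    Y ℤ.* ↧ q′ ℤ.* ↧ q    ≡⟨ cong (ℤ._* ↧ q) (IsRatio⇒cross {q′} {X} {Y} h′) ⟨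
    ↥ q′ ℤ.* X ℤ.* ↧ q    ≡⟨ ℤ*.xy∙z≈xz∙y (↥ q′) X (↧ q) ⟩
    ↥ q′ ℤ.* ↧ q ℤ.* X    ∎)))
  where open ≡-Reasoning

IsRatio-/ : ∀ Y n .{{_ : ℕ.NonZero n}} → IsRatio (Y / n) (+ n) Y
IsRatio-/ Y n = cross⇒IsRatio {Y / n} {+ n} {Y} (begin
  ↥ q ℤ.* + n            ≡⟨ cong (↥ q ℤ.*_) (ℚP.↧-/ Y n) ⟨
  ↥ q ℤ.* (↧ q ℤ.* g)    ≡⟨ ℤ*.x∙yz≈xz∙y (↥ q) (↧ q) g ⟩
  ↥ q ℤ.* g ℤ.* ↧ q      ≡⟨ cong (ℤ._* ↧ q) (ℚP.↥-/ Y n) ⟩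
  Y ℤ.* ↧ q              ∎)
  where
  open ≡-Reasoning
  q : ℚ
  q = Y / n
  g : ℤ
  g = ℤGCD.gcd Y (+ n)

m*m≡0⇒m≡0 : ∀ m → m * m ≡ 0 → m ≡ 0
m*m≡0⇒m≡0 zero    _  = refl
m*m≡0⇒m≡0 (suc _) ()

m*m≤n*n⇒m≤n : ∀ m n → m * m ≤ n * n → m ≤ n
m*m≤n*n⇒m≤n m n mm≤nn with m ℕP.≤? n
... | yes m≤n = m≤n
... | no  m≰n = ⊥-elim (ℕP.<⇒≱ (ℕP.*-mono-< n<m n<m) mm≤nn)
  where
  n<m : n < m
  n<m = ℕP.≰⇒> m≰n

m*m≡n*n⇒m≡n : ∀ m n → m * m ≡ n * n → m ≡ n
m*m≡n*n⇒m≡n m n eq =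
  ℕP.≤-antisym (m*m≤n*n⇒m≤n m n (ℕP.≤-reflexive eq)) (m*m≤n*n⇒m≤n n m (ℕP.≤-reflexive (sym eq)))

m*n<m*m+n*n : ∀ m n → ¬ (m ≡ 0 × n ≡ 0) → m * n < m * m + n * n
m*n<m*m+n*n zero      zero      nz = ⊥-elim (nz (refl , refl))
m*n<m*m+n*n zero      (suc _)   _  = s≤s z≤n
m*n<m*m+n*n (suc m)   zero      _  rewrite ℕP.*-zeroʳ m = s≤s z≤n
m*n<m*m+n*n m@(suc _) n@(suc _) _  with ℕP.≤-total m n
... | inj₁ m≤n = ℕP.+-mono-<-≤ (s≤s z≤n) (ℕP.*-monoˡ-≤ n m≤n)
... | inj₂ n≤m = subst (_< m * m + n * n) (ℕP.+-identityʳ (m * n))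
                   (ℕP.+-mono-≤-< (ℕP.*-monoʳ-≤ m n≤m) (s≤s z≤n))

+∣i∣*∣i∣≡i*i : ∀ i → + (∣ i ∣ * ∣ i ∣) ≡ i ℤ.* i
+∣i∣*∣i∣≡i*i (+ n)      = ℤP.pos-* n n
+∣i∣*∣i∣≡i*i ℤ.-[1+ n ] = refl

∣i∣≡∣j∣⇒i≡j⊎i≡-j : ∀ i j → ∣ i ∣ ≡ ∣ j ∣ → i ≡ j ⊎ i ≡ ℤ.- j
∣i∣≡∣j∣⇒i≡j⊎i≡-j (+ _)      (+ _)      eq   = inj₁ (cong +_ eq)
∣i∣≡∣j∣⇒i≡j⊎i≡-j (+ _)      ℤ.-[1+ _ ] eq   = inj₂ (cong +_ eq)
∣i∣≡∣j∣⇒i≡j⊎i≡-j ℤ.-[1+ _ ] (+ _)      refl = inj₂ refl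
∣i∣≡∣j∣⇒i≡j⊎i≡-j ℤ.-[1+ _ ] ℤ.-[1+ _ ] eq   = inj₁ (cong ℤ.-[1+_] (ℕP.suc-injective eq))

pos-*+* : ∀ m n o p → + (m * n + o * p) ≡ + m ℤ.* + n ℤ.+ + o ℤ.* + p
pos-*+* m n o p = cong₂ ℤ._+_ (ℤP.pos-* m n) (ℤP.pos-* o p)

pos-∸ : ∀ {m n} → n ≤ m → + (m ∸ n) ≡ + m ℤ.- + n
pos-∸ {m} {n} n≤m = sym (trans (ℤP.[+m]-[+n]≡m⊖n m n) (ℤP.⊖-≥ n≤m))

pos-k*[m*n] : ∀ k m n → + (k * (m * n)) ≡ + k ℤ.* (+ m ℤ.* + n)
pos-k*[m*n] k m n = trans (ℤP.pos-* k (m * n)) (cong (+ k ℤ.*_) (ℤP.pos-* m n))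

pos-k*[*+*] : ∀ k m n o p → + (k * (m * n + o * p)) ≡ + k ℤ.* (+ m ℤ.* + n ℤ.+ + o ℤ.* + p)
pos-k*[*+*] k m n o p = trans (ℤP.pos-* k (m * n + o * p)) (cong (+ k ℤ.*_) (pos-*+* m n o p))

pos-*-injective : ∀ {m n o p} → + m ℤ.* + n ≡ + o ℤ.* + p → m * n ≡ o * p
pos-*-injective {m} {n} {o} {p} eq = ℤP.+-injective (trans (ℤP.pos-* m n) (trans eq (sym (ℤP.pos-* o p))))

+[2*n]≢0 : ∀ {n} → n ≢ 0 → + (2 * n) ≢ ℤ.0ℤ
+[2*n]≢0 n≢0 = n≢0 ∘ [ (λ ()) , id ]′ ∘ ℕP.m*n≡0⇒m≡0∨n≡0 2 ∘ ℤP.+-injective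

gcd₃ : ℕ → ℕ → ℕ → ℕ
gcd₃ a b c = gcd (gcd a b) c

∣gcd₃ : ∀ {d a b c} → d ∣ a → d ∣ b → d ∣ c → d ∣ gcd₃ a b c
∣gcd₃ d∣a d∣b d∣c = gcd-greatest (gcd-greatest d∣a d∣b) d∣c

gcd₃-*ˡ : ∀ k a b c → gcd₃ (k * a) (k * b) (k * c) ≡ k * gcd₃ a b c
gcd₃-*ˡ k a b c = trans (cong (λ g → gcd g (k * c)) (sym (c*gcd[m,n]≡gcd[cm,cn] k a b)))
                        (sym (c*gcd[m,n]≡gcd[cm,cn] k (gcd a b) c))

gcd[n∸m,n]≡gcd[m,n] : ∀ {m n} → m ≤ n → gcd (n ∸ m) n ≡ gcd m n
gcd[n∸m,n]≡gcd[m,n] {m} {n} m≤n = ∣-antisym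
  (gcd-greatest (∣m+n∣m⇒∣n (subst (gcd (n ∸ m) n ∣_) (sym (ℕP.m∸n+n≡m m≤n)) (gcd[m,n]∣n (n ∸ m) n))
                           (gcd[m,n]∣m (n ∸ m) n))
                (gcd[m,n]∣n (n ∸ m) n))
  (gcd-greatest (∣m+n∣m⇒∣n (subst (gcd m n ∣_) (sym (ℕP.m+[n∸m]≡n m≤n)) (gcd[m,n]∣n m n))
                           (gcd[m,n]∣m m n))
                (gcd[m,n]∣n m n))

gcd₃≡1-proportional⇒≡ : ∀ {a b c a′ b′ c′} → gcd₃ a b c ≡ 1 → gcd₃ a′ b′ c′ ≡ 1 → c ≢ 0 →
  a′ * c ≡ a * c′ → b′ * c ≡ b * c′ → (a′ , b′ , c′) ≡ (a , b , c)
gcd₃≡1-proportional⇒≡ {a} {b} {c} {a′} {b′} {c′} coprime coprime′ c≢0 a′c≡ac′ b′c≡bc′ =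
  cong₂ _,_ (cancel a′c≡ac′) (cong₂ _,_ (cancel b′c≡bc′) c′≡c)
  where
  instance
    c-nonZero : ℕ.NonZero c
    c-nonZero = ℕ.≢-nonZero c≢0
  commute : ∀ {x y} → x * c ≡ y * c′ → c′ * y ≡ c * x
  commute {x} {y} eq = trans (ℕP.*-comm c′ y) (trans (sym eq) (ℕP.*-comm x c))
  c′≡c : c′ ≡ c
  c′≡c = begin
    c′                               ≡⟨ ℕP.*-identityʳ c′ ⟨
    c′ * 1                           ≡⟨ cong (c′ *_) coprime ⟨
    c′ * gcd₃ a b c                  ≡⟨ gcd₃-*ˡ c′ a b c ⟨
    gcd₃ (c′ * a) (c′ * b) (c′ * c)  ≡⟨ cong₂ (λ x y → gcd₃ x y (c′ * c)) (commute a′c≡ac′) (commute b′c≡bc′) ⟩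
    gcd₃ (c * a′) (c * b′) (c′ * c)  ≡⟨ cong (gcd₃ (c * a′) (c * b′)) (ℕP.*-comm c′ c) ⟩
    gcd₃ (c * a′) (c * b′) (c * c′)  ≡⟨ gcd₃-*ˡ c a′ b′ c′ ⟩
    c * gcd₃ a′ b′ c′                ≡⟨ cong (c *_) coprime′ ⟩
    c * 1                            ≡⟨ ℕP.*-identityʳ c ⟩
    c                                ∎
    where open ≡-Reasoning
  cancel : ∀ {x y} → x * c ≡ y * c′ → x ≡ y
  cancel {x} {y} eq = ℕP.*-cancelʳ-≡ x y c (trans eq (cong (y *_) c′≡c))

prime[3] : Prime 3
prime[3] = toWitness {a? = prime? 3} _

-- Eisenstein triples

EisensteinEq : ℕ → ℕ → ℕ → Set
EisensteinEq a b c = a * a + b * b ≡ a * b + c * c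

-- (p / 2n , √3 B / 2n) lies on the unit circle.
OnUnitCircle : ℕ → ℕ → ℕ → Set
OnUnitCircle p B n = p * p + 3 * (B * B) ≡ 4 * (n * n)

δ : ℕ → ℕ → ℤ
δ a b = + b ℤ.- + 2 ℤ.* + a

-- Without subtraction, δ² + 3b² - 4c² = 4 (a² + b² - ab - c²) is an identity of ℕ.
eisenstein-identity : ∀ a b c →
  ∣ δ a b ∣ * ∣ δ a b ∣ + 3 * (b * b) + 4 * (a * b + c * c) ≡ 4 * (c * c) + 4 * (a * a + b * b)
eisenstein-identity a b c = ℤP.+-injective (begin
  + (∣ δ a b ∣ * ∣ δ a b ∣ + 3 * (b * b) + 4 * (a * b + c * c))
    ≡⟨ cong₂ ℤ._+_ (cong₂ ℤ._+_ (+∣i∣*∣i∣≡i*i (δ a b)) (pos-k*[m*n] 3 b b)) (pos-k*[*+*] 4 a b c c) ⟩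
  δ a b ℤ.* δ a b ℤ.+ + 3 ℤ.* (+ b ℤ.* + b) ℤ.+ + 4 ℤ.* (+ a ℤ.* + b ℤ.+ + c ℤ.* + c)
    ≡⟨ identity (+ a) (+ b) (+ c) ⟩
  + 4 ℤ.* (+ c ℤ.* + c) ℤ.+ + 4 ℤ.* (+ a ℤ.* + a ℤ.+ + b ℤ.* + b)
    ≡⟨ cong₂ ℤ._+_ (pos-k*[m*n] 4 c c) (pos-k*[*+*] 4 a a b b) ⟨
  + (4 * (c * c) + 4 * (a * a + b * b)) ∎)
  where
  open ≡-Reasoning
  identity : ∀ A B C → (B ℤ.- + 2 ℤ.* A) ℤ.* (B ℤ.- + 2 ℤ.* A) ℤ.+ + 3 ℤ.* (B ℤ.* B) ℤ.+ + 4 ℤ.* (A ℤ.* B ℤ.+ C ℤ.* C)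
                     ≡ + 4 ℤ.* (C ℤ.* C) ℤ.+ + 4 ℤ.* (A ℤ.* A ℤ.+ B ℤ.* B)
  identity = ℤSolver.solve-∀

eisenstein⇒onCircle : ∀ {a b c} → EisensteinEq a b c → OnUnitCircle ∣ δ a b ∣ b c
eisenstein⇒onCircle {a} {b} {c} eq = ℕP.+-cancelʳ-≡ (4 * (a * b + c * c)) _ _
  (trans (eisenstein-identity a b c) (cong (λ x → 4 * (c * c) + 4 * x) eq))

onCircle⇒eisenstein : ∀ {a b c} → OnUnitCircle ∣ δ a b ∣ b c → EisensteinEq a b c
onCircle⇒eisenstein {a} {b} {c} eq = sym (ℕP.*-cancelˡ-≡ _ _ 4 (ℕP.+-cancelˡ-≡ (4 * (c * c)) _ _
  (trans (cong (_+ 4 * (a * b + c * c)) (sym eq)) (eisenstein-identity a b c))))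

onCircle-*ʳ : ∀ {p B n} k → OnUnitCircle p B n → OnUnitCircle (p * k) (B * k) (n * k)
onCircle-*ʳ {p} {B} {n} k eq = begin
  p * k * (p * k) + 3 * (B * k * (B * k)) ≡⟨ identityˡ p B k ⟩
  (p * p + 3 * (B * B)) * (k * k)         ≡⟨ cong (_* (k * k)) eq ⟩
  4 * (n * n) * (k * k)                   ≡⟨ identityʳ n k ⟩
  4 * (n * k * (n * k))                   ∎
  where
  open ≡-Reasoning
  identityˡ : ∀ x y z → x * z * (x * z) + 3 * (y * z * (y * z)) ≡ (x * x + 3 * (y * y)) * (z * z)
  identityˡ = ℕSolver.solve-∀
  identityʳ : ∀ x z → 4 * (x * x) * (z * z) ≡ 4 * (x * z * (x * z))
  identityʳ = ℕSolver.solve-∀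

onCircle-unique : ∀ {p B B′ n} → OnUnitCircle p B n → OnUnitCircle p B′ n → B ≡ B′
onCircle-unique {p} {B} {B′} eq eq′ =
  m*m≡n*n⇒m≡n B B′ (ℕP.*-cancelˡ-≡ _ _ 3 (ℕP.+-cancelˡ-≡ (p * p) _ _ (trans eq (sym eq′))))

onCircle⇒n≢0 : ∀ {p B n} → OnUnitCircle p B n → B ≢ 0 → n ≢ 0
onCircle⇒n≢0 {p} {B} circle B≢0 refl =
  B≢0 (m*m≡0⇒m≡0 B ([ (λ ()) , id ]′ (ℕP.m*n≡0⇒m≡0∨n≡0 3 (ℕP.m+n≡0⇒n≡0 (p * p) circle))))

δ-flip : ∀ {a b} → a ≤ b → δ (b ∸ a) b ≡ ℤ.- δ a b
δ-flip {a} {b} a≤b = trans (cong (λ x → + b ℤ.- + 2 ℤ.* x) (pos-∸ a≤b)) (identity (+ a) (+ b))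
  where
  identity : ∀ A B → B ℤ.- + 2 ℤ.* (B ℤ.- A) ≡ ℤ.- (B ℤ.- + 2 ℤ.* A)
  identity = ℤSolver.solve-∀

∣δ-flip∣ : ∀ {a b} → a ≤ b → ∣ δ (b ∸ a) b ∣ ≡ ∣ δ a b ∣
∣δ-flip∣ {a} {b} a≤b = trans (cong ∣_∣ (δ-flip a≤b)) (ℤP.∣-i∣≡∣i∣ (δ a b))

∣δ-*ʳ∣ : ∀ a b k → ∣ δ (a * k) (b * k) ∣ ≡ ∣ δ a b ∣ * k
∣δ-*ʳ∣ a b k = begin
  ∣ δ (a * k) (b * k) ∣              ≡⟨ cong₂ (λ x y → ∣ x ℤ.- + 2 ℤ.* y ∣) (ℤP.pos-* b k) (ℤP.pos-* a k) ⟩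
  ∣ + b ℤ.* + k ℤ.- + 2 ℤ.* (+ a ℤ.* + k) ∣ ≡⟨ cong ∣_∣ (identity (+ a) (+ b) (+ k)) ⟩
  ∣ δ a b ℤ.* + k ∣                  ≡⟨ ℤP.∣i*j∣≡∣i∣*∣j∣ (δ a b) (+ k) ⟩
  ∣ δ a b ∣ * k                      ∎
  where
  open ≡-Reasoning
  identity : ∀ A B K → B ℤ.* K ℤ.- + 2 ℤ.* (A ℤ.* K) ≡ (B ℤ.- + 2 ℤ.* A) ℤ.* K
  identity = ℤSolver.solve-∀

eisenstein-flip : ∀ {a b c} → a ≤ b → EisensteinEq a b c → EisensteinEq (b ∸ a) b c
eisenstein-flip {a} {b} {c} a≤b eq =
  onCircle⇒eisenstein {b ∸ a} {b} {c}
    (subst (λ e → OnUnitCircle e b c) (sym (∣δ-flip∣ a≤b)) (eisenstein⇒onCircle {a} {b} {c} eq))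

eisenstein-*ʳ⇒eisenstein : ∀ {a b c} k → k ≢ 0 → EisensteinEq (a * k) (b * k) (c * k) → EisensteinEq a b c
eisenstein-*ʳ⇒eisenstein {a} {b} {c} k k≢0 eq =
  ℕP.*-cancelʳ-≡ _ _ (k * k) {{ℕ.≢-nonZero (k≢0 ∘ m*m≡0⇒m≡0 k)}}
    (trans (identityˡ a b k) (trans eq (identityʳ a b c k)))
  where
  identityˡ : ∀ x y z → (x * x + y * y) * (z * z) ≡ x * z * (x * z) + y * z * (y * z)
  identityˡ = ℕSolver.solve-∀
  identityʳ : ∀ x y w z → x * z * (y * z) + w * z * (w * z) ≡ (x * y + w * w) * (z * z)
  identityʳ = ℕSolver.solve-∀

eisenstein⇒c≤b : ∀ {a b c} → a ≤ b → EisensteinEq a b c → c ≤ b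
eisenstein⇒c≤b {a} {b} {c} a≤b eq = m*m≤n*n⇒m≤n c b (ℕP.+-cancelˡ-≤ (a * b) (c * c) (b * b) (begin
  a * b + c * c ≡⟨ eq ⟨
  a * a + b * b ≤⟨ ℕP.+-monoˡ-≤ (b * b) (ℕP.*-monoʳ-≤ a a≤b) ⟩
  a * b + b * b ∎))
  where open ℕP.≤-Reasoning

eisenstein⇒∣δ∣≤c : ∀ {a b c} → a ≤ b → EisensteinEq a b c → ∣ δ a b ∣ ≤ c
eisenstein⇒∣δ∣≤c {a} {b} {c} a≤b eq = m*m≤n*n⇒m≤n e c (ℕP.+-cancelʳ-≤ (3 * (c * c)) (e * e) (c * c) (begin
  e * e + 3 * (c * c) ≤⟨ ℕP.+-monoʳ-≤ (e * e) (ℕP.*-monoʳ-≤ 3 (ℕP.*-mono-≤ c≤b c≤b)) ⟩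
  e * e + 3 * (b * b) ≡⟨ eisenstein⇒onCircle {a} {b} {c} eq ⟩
  4 * (c * c)         ∎))
  where
  open ℕP.≤-Reasoning
  e : ℕ
  e = ∣ δ a b ∣
  c≤b : c ≤ b
  c≤b = eisenstein⇒c≤b {a} {b} {c} a≤b eq

primitive⇒b≢0 : ∀ {a b c} → PrimitiveEisenstein a b c → b ≢ 0
primitive⇒b≢0 {a} {b} {c} ((nonzero , eq) , a≤b , _) refl with ℕP.n≤0⇒n≡0 a≤b
... | refl = nonzero (refl , refl , m*m≡0⇒m≡0 c (sym eq))

eisenstein⇒c≢0 : ∀ {a b c} → EisensteinTriple a b c → c ≢ 0
eisenstein⇒c≢0 {a} {b} (nonzero , eq) refl =
  ℕP.<⇒≢ (m*n<m*m+n*n a b λ { (a≡0 , b≡0) → nonzero (a≡0 , b≡0 , refl) })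
         (trans (sym (ℕP.+-identityʳ (a * b))) (sym eq))

primitive-flip : ∀ {a b c} → PrimitiveEisenstein a b c → PrimitiveEisenstein (b ∸ a) b c
primitive-flip {a} {b} {c} prim@((_ , eq) , a≤b , coprime) =
  ((λ (_ , b≡0 , _) → primitive⇒b≢0 prim b≡0) , eisenstein-flip {a} {b} {c} a≤b eq) ,
  ℕP.m∸n≤m b a ,
  trans (cong (λ g → gcd g c) (gcd[n∸m,n]≡gcd[m,n] a≤b)) coprime

-- b = 2a would force c² = 3a², so 3 would divide a, b and c.
primitive⇒a≢b∸a : ∀ {a b c} → PrimitiveEisenstein a b c → a ≢ b ∸ a
primitive⇒a≢b∸a {a} {b} {c} ((_ , eq) , a≤b , coprime) a≡b∸a =
  ℕP.<⇒≢ (s≤s (s≤s z≤n)) (sym (∣1⇒≡1 (subst (3 ∣_) coprime (∣gcd₃ 3∣a 3∣b 3∣c))))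
  where
  b≡a+a : b ≡ a + a
  b≡a+a = trans (sym (ℕP.m+[n∸m]≡n a≤b)) (cong (λ x → a + x) (sym a≡b∸a))
  ∣δ∣≡0 : ∣ δ a b ∣ ≡ 0
  ∣δ∣≡0 = trans (cong (λ x → ∣ δ a x ∣) b≡a+a) (cong ∣_∣ (identity (+ a)))
    where
    identity : ∀ A → A ℤ.+ A ℤ.- + 2 ℤ.* A ≡ ℤ.0ℤ
    identity = ℤSolver.solve-∀
  3a²≡c² : 3 * (a * a) ≡ c * c
  3a²≡c² = ℕP.*-cancelˡ-≡ _ _ 4 (begin
    4 * (3 * (a * a))                                 ≡⟨ identity a ⟩
    0 * 0 + 3 * ((a + a) * (a + a))                   ≡⟨ cong₂ (λ e x → e * e + 3 * (x * x)) ∣δ∣≡0 b≡a+a ⟨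
    ∣ δ a b ∣ * ∣ δ a b ∣ + 3 * (b * b)               ≡⟨ eisenstein⇒onCircle {a} {b} {c} eq ⟩
    4 * (c * c)                                       ∎)
    where
    open ≡-Reasoning
    identity : ∀ x → 4 * (3 * (x * x)) ≡ 0 * 0 + 3 * ((x + x) * (x + x))
    identity = ℕSolver.solve-∀
  3∣c : 3 ∣ c
  3∣c = [ id , id ]′ (euclidsLemma c c prime[3] (divides (a * a) (trans (sym 3a²≡c²) (ℕP.*-comm 3 (a * a)))))
  3∣a : 3 ∣ a
  3∣a with 3∣c
  ... | divides k refl = [ id , id ]′ (euclidsLemma a a prime[3] (divides (k * k) (ℕP.*-cancelˡ-≡ _ _ 3 (begin
    3 * (a * a)           ≡⟨ 3a²≡c² ⟩
    k * 3 * (k * 3)       ≡⟨ identity k ⟩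
    3 * (k * k * 3)       ∎))))
    where
    open ≡-Reasoning
    identity : ∀ x → x * 3 * (x * 3) ≡ 3 * (x * x * 3)
    identity = ℕSolver.solve-∀
  3∣b : 3 ∣ b
  3∣b = subst (3 ∣_) (sym b≡a+a) (∣m∣n⇒∣m+n 3∣a 3∣a)

primitive-δ-proportional⇒≡ : ∀ {a b c a′ b′ c′} →
  PrimitiveEisenstein a b c → PrimitiveEisenstein a′ b′ c′ →
  b′ * c ≡ b * c′ → δ a′ b′ ℤ.* + c ≡ δ a b ℤ.* + c′ → (a′ , b′ , c′) ≡ (a , b , c)
primitive-δ-proportional⇒≡ {a} {b} {c} {a′} {b′} {c′} prim@(_ , _ , coprime) (_ , _ , coprime′) b′c≡bc′ δ′c≡δc′ =
  gcd₃≡1-proportional⇒≡ coprime coprime′ (eisenstein⇒c≢0 (proj₁ prim)) a′c≡ac′ b′c≡bc′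
  where
  open ≡-Reasoning
  identity : ∀ A B C → + 2 ℤ.* (A ℤ.* C) ≡ B ℤ.* C ℤ.- (B ℤ.- + 2 ℤ.* A) ℤ.* C
  identity = ℤSolver.solve-∀
  a′c≡ac′ : a′ * c ≡ a * c′
  a′c≡ac′ = ℤP.+-injective (ℤP.*-cancelˡ-≡ (+ 2) _ _ (begin
    + 2 ℤ.* + (a′ * c)                 ≡⟨ cong (+ 2 ℤ.*_) (ℤP.pos-* a′ c) ⟩
    + 2 ℤ.* (+ a′ ℤ.* + c)             ≡⟨ identity (+ a′) (+ b′) (+ c) ⟩
    + b′ ℤ.* + c ℤ.- δ a′ b′ ℤ.* + c   ≡⟨ cong₂ ℤ._-_ (trans (sym (ℤP.pos-* b′ c)) (trans (cong +_ b′c≡bc′) (ℤP.pos-* b c′))) δ′c≡δc′ ⟩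
    + b ℤ.* + c′ ℤ.- δ a b ℤ.* + c′    ≡⟨ identity (+ a) (+ b) (+ c′) ⟨
    + 2 ℤ.* (+ a ℤ.* + c′)             ≡⟨ cong (+ 2 ℤ.*_) (ℤP.pos-* a c′) ⟨
    + 2 ℤ.* + (a * c′)                 ∎))

-- (b - 2a)² + 3b² = 4c² recovers b / c from |b - 2a| / c, and then (b - 2a) / c up to the sign
-- that the flip a ↦ b - a changes.
∣δ∣-proportional⇒≡⊎≡flip : ∀ {a b c a′ b′ c′} →
  PrimitiveEisenstein a b c → PrimitiveEisenstein a′ b′ c′ → ∣ δ a′ b′ ∣ * c ≡ ∣ δ a b ∣ * c′ →
  (a′ , b′ , c′) ≡ (a , b , c) ⊎ (a′ , b′ , c′) ≡ (b ∸ a , b , c)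
∣δ∣-proportional⇒≡⊎≡flip {a} {b} {c} {a′} {b′} {c′} prim@((_ , eq) , a≤b , _) prim′@((_ , eq′) , _) ∣δ′∣c≡∣δ∣c′ =
  Sum.map (primitive-δ-proportional⇒≡ prim prim′ b′c≡bc′)
          (λ δ′c≡-δc′ → primitive-δ-proportional⇒≡ (primitive-flip prim) prim′ b′c≡bc′ (trans δ′c≡-δc′ -δc′≡δ⁻c′))
          (∣i∣≡∣j∣⇒i≡j⊎i≡-j (δ a′ b′ ℤ.* + c) (δ a b ℤ.* + c′) (begin
            ∣ δ a′ b′ ℤ.* + c ∣    ≡⟨ ℤP.∣i*j∣≡∣i∣*∣j∣ (δ a′ b′) (+ c) ⟩
            ∣ δ a′ b′ ∣ * c        ≡⟨ ∣δ′∣c≡∣δ∣c′ ⟩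
            ∣ δ a b ∣ * c′         ≡⟨ ℤP.∣i*j∣≡∣i∣*∣j∣ (δ a b) (+ c′) ⟨
            ∣ δ a b ℤ.* + c′ ∣     ∎))
  where
  open ≡-Reasoning
  b′c≡bc′ : b′ * c ≡ b * c′
  b′c≡bc′ = onCircle-unique {∣ δ a′ b′ ∣ * c} {b′ * c} {b * c′} {c′ * c}
    (onCircle-*ʳ {∣ δ a′ b′ ∣} {b′} {c′} c (eisenstein⇒onCircle {a′} {b′} {c′} eq′))
    (subst₂ (λ x y → OnUnitCircle x (b * c′) y) (sym ∣δ′∣c≡∣δ∣c′) (ℕP.*-comm c c′)
            (onCircle-*ʳ {∣ δ a b ∣} {b} {c} c′ (eisenstein⇒onCircle {a} {b} {c} eq)))
  -δc′≡δ⁻c′ : ℤ.- (δ a b ℤ.* + c′) ≡ δ (b ∸ a) b ℤ.* + c′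
  -δc′≡δ⁻c′ = trans (ℤP.neg-distribˡ-* (δ a b) (+ c′)) (cong (ℤ._* + c′) (sym (δ-flip a≤b)))

record ScaledPrimitive (a b c : ℕ) : Set where
  field
    a₀ b₀ c₀ g : ℕ
    isPrimitive : PrimitiveEisenstein a₀ b₀ c₀
    a≡a₀*g     : a ≡ a₀ * g
    b≡b₀*g     : b ≡ b₀ * g
    c≡c₀*g     : c ≡ c₀ * g

eisenstein⇒scaledPrimitive : ∀ {a b c} → b ≢ 0 → a ≤ b → EisensteinEq a b c → ScaledPrimitive a b c
eisenstein⇒scaledPrimitive {a} {b} {c} b≢0 a≤b eq = record
  { a₀ = a₀ ; b₀ = b₀ ; c₀ = c₀ ; g = g
  ; isPrimitive = ((λ (_ , b₀≡0 , _) → b≢0 (trans b≡b₀*g (cong (_* g) b₀≡0))) , eq₀) , a₀≤b₀ , coprime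
  ; a≡a₀*g = a≡a₀*g ; b≡b₀*g = b≡b₀*g ; c≡c₀*g = c≡c₀*g
  }
  where
  g : ℕ
  g = gcd₃ a b c
  g≢0 : g ≢ 0
  g≢0 = gcd[m,n]≢0 (gcd a b) c (inj₁ (gcd[m,n]≢0 a b (inj₂ b≢0)))
  instance
    g-nonZero : ℕ.NonZero g
    g-nonZero = ℕ.≢-nonZero g≢0
  g∣a : g ∣ a
  g∣a = ∣-trans (gcd[m,n]∣m (gcd a b) c) (gcd[m,n]∣m a b)
  g∣b : g ∣ b
  g∣b = ∣-trans (gcd[m,n]∣m (gcd a b) c) (gcd[m,n]∣n a b)
  g∣c : g ∣ c
  g∣c = gcd[m,n]∣n (gcd a b) c
  open _∣_ {g} {a} g∣a using () renaming (quotient to a₀; equality to a≡a₀*g)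
  open _∣_ {g} {b} g∣b using () renaming (quotient to b₀; equality to b≡b₀*g)
  open _∣_ {g} {c} g∣c using () renaming (quotient to c₀; equality to c≡c₀*g)
  eq₀ : EisensteinEq a₀ b₀ c₀
  eq₀ = eisenstein-*ʳ⇒eisenstein {a₀} {b₀} {c₀} g g≢0
          (subst₂ (λ x y → EisensteinEq x y (c₀ * g)) a≡a₀*g b≡b₀*g (subst (EisensteinEq a b) c≡c₀*g eq))
  a₀≤b₀ : a₀ ≤ b₀
  a₀≤b₀ = ℕP.*-cancelʳ-≤ a₀ b₀ g (subst₂ _≤_ a≡a₀*g b≡b₀*g a≤b)
  coprime : gcd₃ a₀ b₀ c₀ ≡ 1
  coprime = ℕP.*-cancelˡ-≡ _ _ g (begin
    g * gcd₃ a₀ b₀ c₀                ≡⟨ gcd₃-*ˡ g a₀ b₀ c₀ ⟨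
    gcd₃ (g * a₀) (g * b₀) (g * c₀)  ≡⟨ cong₂ (λ x y → gcd₃ x y (g * c₀)) (ℕP.*-comm g a₀) (ℕP.*-comm g b₀) ⟩
    gcd₃ (a₀ * g) (b₀ * g) (g * c₀)  ≡⟨ cong (gcd₃ (a₀ * g) (b₀ * g)) (ℕP.*-comm g c₀) ⟩
    gcd₃ (a₀ * g) (b₀ * g) (c₀ * g)  ≡⟨ cong₂ (λ x y → gcd₃ x y (c₀ * g)) a≡a₀*g b≡b₀*g ⟨
    gcd₃ a b (c₀ * g)                ≡⟨ cong (gcd₃ a b) c≡c₀*g ⟨
    g                                ≡⟨ ℕP.*-identityʳ g ⟨
    g * 1                            ∎)
    where open ≡-Reasoning

-- (B - p , 2B , 2n) is an Eisenstein triple with |b - 2a| = 2p; divide it by its gcd.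
onCircle⇒primitive : ∀ {p B n} → OnUnitCircle p B n → p ≤ n → B ≢ 0 →
  ∃[ a ] ∃[ b ] ∃[ c ] (PrimitiveEisenstein a b c × p * c ≡ ∣ δ a b ∣ * n)
onCircle⇒primitive {p} {B} {n} circle p≤n B≢0 = a₀ , b₀ , c₀ , isPrimitive , pc₀≡∣δ₀∣n
  where
  p≤B : p ≤ B
  p≤B = m*m≤n*n⇒m≤n p B (ℕP.*-cancelˡ-≤ 3 (ℕP.+-cancelˡ-≤ (p * p) _ _ (begin
    4 * (p * p)           ≤⟨ ℕP.*-monoʳ-≤ 4 (ℕP.*-mono-≤ p≤n p≤n) ⟩
    4 * (n * n)           ≡⟨ circle ⟨
    p * p + 3 * (B * B)   ∎)))
    where open ℕP.≤-Reasoning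
  ∣δ₀∣≡2p : ∣ δ (B ∸ p) (B * 2) ∣ ≡ p * 2
  ∣δ₀∣≡2p = begin
    ∣ δ (B ∸ p) (B * 2) ∣                      ≡⟨ cong₂ (λ x y → ∣ x ℤ.- + 2 ℤ.* y ∣) (ℤP.pos-* B 2) (pos-∸ p≤B) ⟩
    ∣ + B ℤ.* + 2 ℤ.- + 2 ℤ.* (+ B ℤ.- + p) ∣  ≡⟨ cong ∣_∣ (identity (+ p) (+ B)) ⟩
    ∣ + p ℤ.* + 2 ∣                            ≡⟨ cong ∣_∣ (ℤP.pos-* p 2) ⟨
    p * 2                                      ∎
    where
    open ≡-Reasoning
    identity : ∀ P B → B ℤ.* + 2 ℤ.- + 2 ℤ.* (B ℤ.- P) ≡ P ℤ.* + 2
    identity = ℤSolver.solve-∀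
  eq₀ : EisensteinEq (B ∸ p) (B * 2) (n * 2)
  eq₀ = onCircle⇒eisenstein {B ∸ p} {B * 2} {n * 2}
          (subst (λ e → OnUnitCircle e (B * 2) (n * 2)) (sym ∣δ₀∣≡2p) (onCircle-*ʳ {p} {B} {n} 2 circle))
  B*2≢0 : B * 2 ≢ 0
  B*2≢0 = B≢0 ∘ ℕP.m*n≡0⇒m≡0 B 2
  open ScaledPrimitive (eisenstein⇒scaledPrimitive {B ∸ p} {B * 2} {n * 2} B*2≢0 (ℕP.≤-trans (ℕP.m∸n≤m B p) (ℕP.m≤m*n B 2)) eq₀)
  pc₀≡∣δ₀∣n : p * c₀ ≡ ∣ δ a₀ b₀ ∣ * n
  pc₀≡∣δ₀∣n = ℕP.*-cancelʳ-≡ _ _ 2 (begin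
    p * c₀ * 2                ≡⟨ ℕ*.xy∙z≈xz∙y p c₀ 2 ⟩
    p * 2 * c₀                ≡⟨ cong (_* c₀) (trans (sym ∣δ₀∣≡2p) (trans (cong₂ (λ x y → ∣ δ x y ∣) a≡a₀*g b≡b₀*g) (∣δ-*ʳ∣ a₀ b₀ g))) ⟩
    ∣ δ a₀ b₀ ∣ * g * c₀      ≡⟨ ℕ*.xy∙z≈xz∙y ∣ δ a₀ b₀ ∣ g c₀ ⟩
    ∣ δ a₀ b₀ ∣ * c₀ * g      ≡⟨ ℕP.*-assoc ∣ δ a₀ b₀ ∣ c₀ g ⟩
    ∣ δ a₀ b₀ ∣ * (c₀ * g)    ≡⟨ cong (∣ δ a₀ b₀ ∣ *_) c≡c₀*g ⟨
    ∣ δ a₀ b₀ ∣ * (n * 2)     ≡⟨ ℕP.*-assoc ∣ δ a₀ b₀ ∣ n 2 ⟨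
    ∣ δ a₀ b₀ ∣ * n * 2       ∎)
    where open ≡-Reasoning

-- Well-rounded bases of Λ_h

det : Pt → Pt → ℤ
det (x₁ , y₁) (x₂ , y₂) = x₁ ℤ.* y₂ ℤ.- y₁ ℤ.* x₂

norm-comb : ∀ m n u v → norm (comb m n u v) ≡ m ℤ.* m ℤ.* norm u ℤ.+ m ℤ.* n ℤ.* ip2 u v ℤ.+ n ℤ.* n ℤ.* norm v
norm-comb m n (x₁ , y₁) (x₂ , y₂) = identity m n x₁ y₁ x₂ y₂
  where
  identity : ∀ m n x₁ y₁ x₂ y₂ → let x = m ℤ.* x₁ ℤ.+ n ℤ.* x₂ ; y = m ℤ.* y₁ ℤ.+ n ℤ.* y₂ in
    x ℤ.* x ℤ.- x ℤ.* y ℤ.+ y ℤ.* y ≡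
    m ℤ.* m ℤ.* (x₁ ℤ.* x₁ ℤ.- x₁ ℤ.* y₁ ℤ.+ y₁ ℤ.* y₁)
    ℤ.+ m ℤ.* n ℤ.* (+ 2 ℤ.* x₁ ℤ.* x₂ ℤ.- x₁ ℤ.* y₂ ℤ.- y₁ ℤ.* x₂ ℤ.+ + 2 ℤ.* y₁ ℤ.* y₂)
    ℤ.+ n ℤ.* n ℤ.* (x₂ ℤ.* x₂ ℤ.- x₂ ℤ.* y₂ ℤ.+ y₂ ℤ.* y₂)
  identity = ℤSolver.solve-∀

lagrange-identity : ∀ u v → + 4 ℤ.* norm u ℤ.* norm v ≡ ip2 u v ℤ.* ip2 u v ℤ.+ + 3 ℤ.* (det u v ℤ.* det u v)
lagrange-identity (x₁ , y₁) (x₂ , y₂) = identity x₁ y₁ x₂ y₂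
  where
  identity : ∀ x₁ y₁ x₂ y₂ →
    let P = + 2 ℤ.* x₁ ℤ.* x₂ ℤ.- x₁ ℤ.* y₂ ℤ.- y₁ ℤ.* x₂ ℤ.+ + 2 ℤ.* y₁ ℤ.* y₂ ; t = x₁ ℤ.* y₂ ℤ.- y₁ ℤ.* x₂ in
    + 4 ℤ.* (x₁ ℤ.* x₁ ℤ.- x₁ ℤ.* y₁ ℤ.+ y₁ ℤ.* y₁) ℤ.* (x₂ ℤ.* x₂ ℤ.- x₂ ℤ.* y₂ ℤ.+ y₂ ℤ.* y₂) ≡
    P ℤ.* P ℤ.+ + 3 ℤ.* (t ℤ.* t)
  identity = ℤSolver.solve-∀

-- The form is α²N ± αβP + β²N with α = |m|, β = |n|, and αβ < α² + β².
quadratic-form-min : ∀ {N P} → P ≤ N → ∀ m n → ¬ (m ≡ ℤ.0ℤ × n ≡ ℤ.0ℤ) →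
  + N ℤ.≤ m ℤ.* m ℤ.* + N ℤ.+ m ℤ.* n ℤ.* + P ℤ.+ n ℤ.* n ℤ.* + N
quadratic-form-min {N} {P} P≤N m n nonzero = [ positive , negative ]′ (ℤP.+∣i∣≡i⊎+∣i∣≡-i (m ℤ.* n))
  where
  α β : ℕ
  α = ∣ m ∣
  β = ∣ n ∣
  ∣mn∣≡αβ : ∣ m ℤ.* n ∣ ≡ α * β
  ∣mn∣≡αβ = ℤP.∣i*j∣≡∣i∣*∣j∣ m n
  N+αβP≤α²N+β²N : N + α * β * P ≤ α * α * N + β * β * N
  N+αβP≤α²N+β²N = begin
    N + α * β * P             ≤⟨ ℕP.+-monoʳ-≤ N (ℕP.*-monoʳ-≤ (α * β) P≤N) ⟩
    suc (α * β) * N           ≤⟨ ℕP.*-monoˡ-≤ N (m*n<m*m+n*n α β λ (α≡0 , β≡0) → nonzero (ℤP.∣i∣≡0⇒i≡0 α≡0 , ℤP.∣i∣≡0⇒i≡0 β≡0)) ⟩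
    (α * α + β * β) * N       ≡⟨ ℕP.*-distribʳ-+ N (α * α) (β * β) ⟩
    α * α * N + β * β * N     ∎
    where open ℕP.≤-Reasoning
  form≡ : ∀ {s} → m ℤ.* n ≡ s →
    m ℤ.* m ℤ.* + N ℤ.+ m ℤ.* n ℤ.* + P ℤ.+ n ℤ.* n ℤ.* + N ≡ + (α * α * N) ℤ.+ s ℤ.* + P ℤ.+ + (β * β * N)
  form≡ {s} mn≡s = cong₂ ℤ._+_ (cong₂ ℤ._+_ (square m) (cong (ℤ._* + P) mn≡s)) (square n)
    where
    square : ∀ i → i ℤ.* i ℤ.* + N ≡ + (∣ i ∣ * ∣ i ∣ * N)
    square i = trans (cong (ℤ._* + N) (sym (+∣i∣*∣i∣≡i*i i))) (sym (ℤP.pos-* (∣ i ∣ * ∣ i ∣) N))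
  positive : + ∣ m ℤ.* n ∣ ≡ m ℤ.* n → + N ℤ.≤ m ℤ.* m ℤ.* + N ℤ.+ m ℤ.* n ℤ.* + P ℤ.+ n ℤ.* n ℤ.* + N
  positive +∣mn∣≡mn = begin
    + N                                             ≤⟨ ℤ.+≤+ (ℕP.m+n≤o⇒m≤o N N+αβP≤α²N+β²N) ⟩
    + (α * α * N + β * β * N)                       ≤⟨ ℤ.+≤+ (ℕP.+-monoˡ-≤ (β * β * N) (ℕP.m≤m+n (α * α * N) (α * β * P))) ⟩
    + (α * α * N + α * β * P + β * β * N)           ≡⟨ cong (λ x → + (α * α * N) ℤ.+ x ℤ.+ + (β * β * N)) (ℤP.pos-* (α * β) P) ⟩
    + (α * α * N) ℤ.+ + (α * β) ℤ.* + P ℤ.+ + (β * β * N) ≡⟨ form≡ (trans (sym +∣mn∣≡mn) (cong +_ ∣mn∣≡αβ)) ⟨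
    m ℤ.* m ℤ.* + N ℤ.+ m ℤ.* n ℤ.* + P ℤ.+ n ℤ.* n ℤ.* + N ∎
    where open ℤP.≤-Reasoning
  negative : + ∣ m ℤ.* n ∣ ≡ ℤ.- (m ℤ.* n) → + N ℤ.≤ m ℤ.* m ℤ.* + N ℤ.+ m ℤ.* n ℤ.* + P ℤ.+ n ℤ.* n ℤ.* + N
  negative +∣mn∣≡-mn = begin
    + N                                             ≤⟨ ℤ.+≤+ (ℕP.m+n≤o⇒m≤o∸n N N+αβP≤α²N+β²N) ⟩
    + (α * α * N + β * β * N ∸ α * β * P)           ≡⟨ pos-∸ (ℕP.m+n≤o⇒n≤o N N+αβP≤α²N+β²N) ⟩
    + (α * α * N + β * β * N) ℤ.- + (α * β * P)     ≡⟨ cong (λ x → + (α * α * N + β * β * N) ℤ.- x) (ℤP.pos-* (α * β) P) ⟩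
    + (α * α * N + β * β * N) ℤ.- + (α * β) ℤ.* + P ≡⟨ identity (+ (α * α * N)) (+ (α * β)) (+ P) (+ (β * β * N)) ⟩
    + (α * α * N) ℤ.+ ℤ.- + (α * β) ℤ.* + P ℤ.+ + (β * β * N) ≡⟨ form≡ mn≡-αβ ⟨
    m ℤ.* m ℤ.* + N ℤ.+ m ℤ.* n ℤ.* + P ℤ.+ n ℤ.* n ℤ.* + N ∎
    where
    open ℤP.≤-Reasoning
    identity : ∀ A B C D → A ℤ.+ D ℤ.- B ℤ.* C ≡ A ℤ.+ ℤ.- B ℤ.* C ℤ.+ D
    identity = ℤSolver.solve-∀
    mn≡-αβ : m ℤ.* n ≡ ℤ.- + (α * β)
    mn≡-αβ = trans (sym (ℤP.neg-involutive (m ℤ.* n))) (cong ℤ.-_ (trans (sym +∣mn∣≡-mn) (cong +_ ∣mn∣≡αβ)))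

WRBasis-intro : ∀ u v → Indep u v → norm u ≡ norm v → ℤ.0ℤ ℤ.≤ ip2 u v → ip2 u v ℤ.≤ norm u → WRBasis u v
WRBasis-intro u v indep nu≡nv 0≤P P≤N = indep , nu≡nv , minimal , 0≤P , P≤N
  where
  +∣N∣≡N : + ∣ norm u ∣ ≡ norm u
  +∣N∣≡N = ℤP.0≤i⇒+∣i∣≡i (ℤP.≤-trans 0≤P P≤N)
  +∣P∣≡P : + ∣ ip2 u v ∣ ≡ ip2 u v
  +∣P∣≡P = ℤP.0≤i⇒+∣i∣≡i 0≤P
  minimal : ∀ m n → ¬ (m ≡ ℤ.0ℤ × n ≡ ℤ.0ℤ) → norm u ℤ.≤ norm (comb m n u v)
  minimal m n nonzero = subst₂ ℤ._≤_ +∣N∣≡N (sym form≡)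
    (quadratic-form-min (ℤP.drop‿+≤+ (subst₂ ℤ._≤_ (sym +∣P∣≡P) (sym +∣N∣≡N) P≤N)) m n nonzero)
    where
    form≡ : norm (comb m n u v) ≡ m ℤ.* m ℤ.* + ∣ norm u ∣ ℤ.+ m ℤ.* n ℤ.* + ∣ ip2 u v ∣ ℤ.+ n ℤ.* n ℤ.* + ∣ norm u ∣
    form≡ = trans (norm-comb m n u v)
      (trans (cong (λ x → m ℤ.* m ℤ.* norm u ℤ.+ m ℤ.* n ℤ.* ip2 u v ℤ.+ n ℤ.* n ℤ.* x) (sym nu≡nv))
             (cong₂ (λ N P → m ℤ.* m ℤ.* N ℤ.+ m ℤ.* n ℤ.* P ℤ.+ n ℤ.* n ℤ.* N) (sym +∣N∣≡N) (sym +∣P∣≡P)))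

-- Angles in C_h and primitive triples

InCh⇒onCircle : ∀ {q} → InCh q →
  ∃[ p ] ∃[ B ] ∃[ n ] (OnUnitCircle p B n × p ≤ n × B ≢ 0 × IsRatio q (+ (2 * n)) (+ p))
InCh⇒onCircle {q} (u@(x₁ , y₁) , v@(x₂ , y₂) , (indep , nu≡nv , _ , 0≤P , P≤N) , cos) =
  (∣ P ∣) , (∣ t ∣) , (∣ N ∣) , circle , ℤP.drop‿+≤+ (subst₂ ℤ._≤_ (sym +∣P∣≡P) (sym +∣N∣≡N) P≤N) ,
  indep ∘ ℤP.∣i∣≡0⇒i≡0 , subst₂ (IsRatio q) +2N≡ (sym +∣P∣≡P) cos
  where
  N P t : ℤ
  N = norm u
  P = ip2 u v
  t = det u v
  +∣N∣≡N : + ∣ N ∣ ≡ N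
  +∣N∣≡N = ℤP.0≤i⇒+∣i∣≡i (ℤP.≤-trans 0≤P P≤N)
  +∣P∣≡P : + ∣ P ∣ ≡ P
  +∣P∣≡P = ℤP.0≤i⇒+∣i∣≡i 0≤P
  +2N≡ : + 2 ℤ.* N ≡ + (2 * ∣ N ∣)
  +2N≡ = trans (cong (+ 2 ℤ.*_) (sym +∣N∣≡N)) (sym (ℤP.pos-* 2 ∣ N ∣))
  circle : OnUnitCircle (∣ P ∣) (∣ t ∣) (∣ N ∣)
  circle = ℤP.+-injective (begin
    + (∣ P ∣ * ∣ P ∣ + 3 * (∣ t ∣ * ∣ t ∣))        ≡⟨ cong (λ x → + (∣ P ∣ * ∣ P ∣) ℤ.+ x) (ℤP.pos-* 3 (∣ t ∣ * ∣ t ∣)) ⟩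
    + (∣ P ∣ * ∣ P ∣) ℤ.+ + 3 ℤ.* + (∣ t ∣ * ∣ t ∣) ≡⟨ cong₂ (λ x y → x ℤ.+ + 3 ℤ.* y) (+∣i∣*∣i∣≡i*i P) (+∣i∣*∣i∣≡i*i t) ⟩
    P ℤ.* P ℤ.+ + 3 ℤ.* (t ℤ.* t)                  ≡⟨ lagrange-identity u v ⟨
    + 4 ℤ.* N ℤ.* norm v                           ≡⟨ cong (λ x → + 4 ℤ.* N ℤ.* x) nu≡nv ⟨
    + 4 ℤ.* N ℤ.* N                                ≡⟨ ℤP.*-assoc (+ 4) N N ⟩
    + 4 ℤ.* (N ℤ.* N)                              ≡⟨ cong (λ x → + 4 ℤ.* x) (+∣i∣*∣i∣≡i*i N) ⟨
    + 4 ℤ.* + (∣ N ∣ * ∣ N ∣)                      ≡⟨ ℤP.pos-* 4 (∣ N ∣ * ∣ N ∣) ⟨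
    + (4 * (∣ N ∣ * ∣ N ∣))                        ∎)
    where open ≡-Reasoning

-- Destructured by helper functions, not `with`: with-abstraction over the hypothesis
-- IsRatio q … makes Agda normalise its rational arithmetic and exhaust memory.
InCh⇒primitive : ∀ {q} → InCh q → ∃[ a ] ∃[ b ] ∃[ c ] (PrimitiveEisenstein a b c × CosEq q a b c)
InCh⇒primitive {q} inCh = fromCircle (InCh⇒onCircle {q} inCh)
  where
  fromCircle : ∃[ p ] ∃[ B ] ∃[ n ] (OnUnitCircle p B n × p ≤ n × B ≢ 0 × IsRatio q (+ (2 * n)) (+ p)) →
    ∃[ a ] ∃[ b ] ∃[ c ] (PrimitiveEisenstein a b c × CosEq q a b c)
  fromCircle (p , B , n , circle , p≤n , B≢0 , ratio) = fromPrimitive (onCircle⇒primitive {p} {B} {n} circle p≤n B≢0)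
    where
    fromPrimitive : ∃[ a ] ∃[ b ] ∃[ c ] (PrimitiveEisenstein a b c × p * c ≡ ∣ δ a b ∣ * n) →
      ∃[ a ] ∃[ b ] ∃[ c ] (PrimitiveEisenstein a b c × CosEq q a b c)
    fromPrimitive (a , b , c , prim , pc≡∣δ∣n) = a , b , c , prim ,
      IsRatio-transfer {q} {+ (2 * n)} {+ p} {+ (2 * c)} {+ ∣ δ a b ∣} (+[2*n]≢0 (onCircle⇒n≢0 {p} {B} {n} circle B≢0)) (begin
        + p ℤ.* + (2 * c)       ≡⟨ ℤP.pos-* p (2 * c) ⟨
        + (p * (2 * c))         ≡⟨ cong +_ (ℕ*.x∙yz≈y∙xz p 2 c) ⟩
        + (2 * (p * c))         ≡⟨ cong (λ x → + (2 * x)) pc≡∣δ∣n ⟩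
        + (2 * (∣ δ a b ∣ * n)) ≡⟨ cong +_ (ℕ*.x∙yz≈y∙xz 2 ∣ δ a b ∣ n) ⟩
        + (∣ δ a b ∣ * (2 * n)) ≡⟨ ℤP.pos-* ∣ δ a b ∣ (2 * n) ⟩
        + ∣ δ a b ∣ ℤ.* + (2 * n) ∎) ratio
      where open ≡-Reasoning

-- With b ≤ 2x the basis (c , 0) , (x , b) has 2⟨u , v⟩ = c (2x - b) ≥ 0.
primitive⇒oriented : ∀ {a b c} → PrimitiveEisenstein a b c →
  ∃[ x ] (EisensteinEq x b c × ℤ.- δ x b ≡ + ∣ δ a b ∣)
primitive⇒oriented {a} {b} {c} ((_ , eq) , a≤b , _) = [ flipped , unflipped ]′ (ℤP.+∣i∣≡i⊎+∣i∣≡-i (δ a b))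
  where
  flipped : + ∣ δ a b ∣ ≡ δ a b → ∃[ x ] (EisensteinEq x b c × ℤ.- δ x b ≡ + ∣ δ a b ∣)
  flipped +∣δ∣≡δ = b ∸ a , eisenstein-flip {a} {b} {c} a≤b eq ,
    trans (cong ℤ.-_ (δ-flip a≤b)) (trans (ℤP.neg-involutive (δ a b)) (sym +∣δ∣≡δ))
  unflipped : + ∣ δ a b ∣ ≡ ℤ.- δ a b → ∃[ x ] (EisensteinEq x b c × ℤ.- δ x b ≡ + ∣ δ a b ∣)
  unflipped +∣δ∣≡-δ = a , eq , sym +∣δ∣≡-δ

primitive⇒InCh : ∀ {a b c} → PrimitiveEisenstein a b c → ∃[ q ] (InCh q × CosEq q a b c)
primitive⇒InCh {a} {b} {c} prim@((_ , eq) , a≤b , _) = q , (inCh (primitive⇒oriented prim) , cosEq)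
  where
  c≢0 : c ≢ 0
  c≢0 = eisenstein⇒c≢0 (proj₁ prim)
  instance
    c-nonZero : ℕ.NonZero c
    c-nonZero = ℕ.≢-nonZero c≢0
    2c-nonZero : ℕ.NonZero (2 * c)
    2c-nonZero = ℕP.m*n≢0 2 c
  q : ℚ
  q = + ∣ δ a b ∣ / (2 * c)
  cosEq : CosEq q a b c
  cosEq = IsRatio-/ (+ ∣ δ a b ∣) (2 * c)
  inCh : ∃[ x ] (EisensteinEq x b c × ℤ.- δ x b ≡ + ∣ δ a b ∣) → InCh q
  inCh (x , eqₓ , -δₓ≡∣δ∣) = u , v , basis , cos
    where
    u v : Pt
    u = (+ c , + 0)
    v = (+ x , + b)
    norm-u : norm u ≡ + (c * c)
    norm-u = trans (identity (+ c)) (sym (ℤP.pos-* c c))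
      where
      identity : ∀ C → C ℤ.* C ℤ.- C ℤ.* + 0 ℤ.+ + 0 ℤ.* + 0 ≡ C ℤ.* C
      identity = ℤSolver.solve-∀
    norm-v : norm v ≡ + (c * c)
    norm-v = begin
      + x ℤ.* + x ℤ.- + x ℤ.* + b ℤ.+ + b ℤ.* + b   ≡⟨ identityˡ (+ x) (+ b) ⟩
      + x ℤ.* + x ℤ.+ + b ℤ.* + b ℤ.- + x ℤ.* + b   ≡⟨ cong (ℤ._- + x ℤ.* + b) (pos-*+* x x b b) ⟨
      + (x * x + b * b) ℤ.- + x ℤ.* + b             ≡⟨ cong (λ y → + y ℤ.- + x ℤ.* + b) eqₓ ⟩
      + (x * b + c * c) ℤ.- + x ℤ.* + b             ≡⟨ cong (ℤ._- + x ℤ.* + b) (pos-*+* x b c c) ⟩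
      + x ℤ.* + b ℤ.+ + c ℤ.* + c ℤ.- + x ℤ.* + b   ≡⟨ identityʳ (+ x) (+ b) (+ c) ⟩
      + c ℤ.* + c                                   ≡⟨ ℤP.pos-* c c ⟨
      + (c * c)                                     ∎
      where
      open ≡-Reasoning
      identityˡ : ∀ X B → X ℤ.* X ℤ.- X ℤ.* B ℤ.+ B ℤ.* B ≡ X ℤ.* X ℤ.+ B ℤ.* B ℤ.- X ℤ.* B
      identityˡ = ℤSolver.solve-∀
      identityʳ : ∀ X B C → X ℤ.* B ℤ.+ C ℤ.* C ℤ.- X ℤ.* B ≡ C ℤ.* C
      identityʳ = ℤSolver.solve-∀
    ip2-uv : ip2 u v ≡ + (c * ∣ δ a b ∣)
    ip2-uv = trans (identity (+ c) (+ x) (+ b)) (trans (cong (+ c ℤ.*_) -δₓ≡∣δ∣) (sym (ℤP.pos-* c ∣ δ a b ∣)))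
      where
      identity : ∀ C X B → + 2 ℤ.* C ℤ.* X ℤ.- C ℤ.* B ℤ.- + 0 ℤ.* X ℤ.+ + 2 ℤ.* + 0 ℤ.* B ≡ C ℤ.* ℤ.- (B ℤ.- + 2 ℤ.* X)
      identity = ℤSolver.solve-∀
    indep : Indep u v
    indep det≡0 = [ c≢0 , primitive⇒b≢0 prim ]′ (ℕP.m*n≡0⇒m≡0∨n≡0 c
      (ℤP.+-injective (trans (ℤP.pos-* c b) (trans (sym (identity (+ c) (+ x) (+ b))) det≡0))))
      where
      identity : ∀ C X B → C ℤ.* B ℤ.- + 0 ℤ.* X ≡ C ℤ.* B
      identity = ℤSolver.solve-∀
    basis : WRBasis u v
    basis = WRBasis-intro u v indep (trans norm-u (sym norm-v))
      (subst (ℤ.0ℤ ℤ.≤_) (sym ip2-uv) (ℤ.+≤+ z≤n))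
      (subst₂ ℤ._≤_ (sym ip2-uv) (sym norm-u) (ℤ.+≤+ (ℕP.*-monoʳ-≤ c (eisenstein⇒∣δ∣≤c {a} {b} {c} a≤b eq))))
    cos : IsCosθ q u v
    cos = IsRatio-transfer {q} {+ (2 * c)} {+ ∣ δ a b ∣} {+ 2 ℤ.* norm u} {ip2 u v} (+[2*n]≢0 c≢0) (begin
      + ∣ δ a b ∣ ℤ.* (+ 2 ℤ.* norm u)              ≡⟨ cong (λ y → + ∣ δ a b ∣ ℤ.* (+ 2 ℤ.* y)) norm-u ⟩
      + ∣ δ a b ∣ ℤ.* (+ 2 ℤ.* + (c * c))           ≡⟨ cong (+ ∣ δ a b ∣ ℤ.*_) (ℤP.pos-* 2 (c * c)) ⟨
      + ∣ δ a b ∣ ℤ.* + (2 * (c * c))               ≡⟨ ℤP.pos-* ∣ δ a b ∣ (2 * (c * c)) ⟨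
      + (∣ δ a b ∣ * (2 * (c * c)))                 ≡⟨ cong +_ (identity ∣ δ a b ∣ c) ⟩
      + (c * ∣ δ a b ∣ * (2 * c))                   ≡⟨ ℤP.pos-* (c * ∣ δ a b ∣) (2 * c) ⟩
      + (c * ∣ δ a b ∣) ℤ.* + (2 * c)               ≡⟨ cong (ℤ._* + (2 * c)) ip2-uv ⟨
      ip2 u v ℤ.* + (2 * c)                         ∎) cosEq
      where
      open ≡-Reasoning
      identity : ∀ e c → e * (2 * (c * c)) ≡ c * e * (2 * c)
      identity = ℕSolver.solve-∀

CosEq-flip : ∀ {q a b c} → a ≤ b → CosEq q a b c → CosEq q (b ∸ a) b c
CosEq-flip {q} {a} {b} {c} a≤b = subst (λ e → IsRatio q (+ (2 * c)) (+ e)) (sym (∣δ-flip∣ a≤b))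

CosEq-unique : ∀ {q q′ a b c} → c ≢ 0 → CosEq q a b c → CosEq q′ a b c → q ≡ q′
CosEq-unique {q} {q′} {a} {b} {c} c≢0 = IsRatio-unique {q} {q′} {+ (2 * c)} {+ ∣ δ a b ∣}
  (+[2*n]≢0 c≢0)

CosEq⇒∣δ∣-proportional : ∀ {q a b c a′ b′ c′} → CosEq q a b c → CosEq q a′ b′ c′ → ∣ δ a′ b′ ∣ * c ≡ ∣ δ a b ∣ * c′
CosEq⇒∣δ∣-proportional {q} {a} {b} {c} {a′} {b′} {c′} cos cos′ = ℕP.*-cancelˡ-≡ _ _ 2 (begin
  2 * (∣ δ a′ b′ ∣ * c)   ≡⟨ ℕ*.x∙yz≈y∙xz 2 ∣ δ a′ b′ ∣ c ⟩
  ∣ δ a′ b′ ∣ * (2 * c)   ≡⟨ pos-*-injective {∣ δ a b ∣} {2 * c′} {∣ δ a′ b′ ∣} {2 * c} (IsRatio-cross {q} {+ (2 * c)} {+ ∣ δ a b ∣} {+ (2 * c′)} {+ ∣ δ a′ b′ ∣} cos cos′) ⟨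
  ∣ δ a b ∣ * (2 * c′)    ≡⟨ ℕ*.x∙yz≈y∙xz ∣ δ a b ∣ 2 c′ ⟩
  2 * (∣ δ a b ∣ * c′)    ∎)
  where open ≡-Reasoning

corollary4p6 : ((q : ℚ) → InCh q →
    ∃[ a ] ∃[ b ] ∃[ c ]
      (PrimitiveEisenstein a b c × PrimitiveEisenstein (b ∸ a) b c ×
       (a , b , c) ≢ (b ∸ a , b , c) ×
       CosEq q a b c × CosEq q (b ∸ a) b c ×
       ((a' b' c' : ℕ) → PrimitiveEisenstein a' b' c' → CosEq q a' b' c' →
         (a' , b' , c') ≡ (a , b , c) ⊎ (a' , b' , c') ≡ (b ∸ a , b , c))))
  ×
  ((a b c : ℕ) → PrimitiveEisenstein a b c →
    ∃[ q ] ((InCh q × CosEq q a b c) ×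
      ((q' : ℚ) → InCh q' → CosEq q' a b c → q' ≡ q)))
corollary4p6 =
  (λ q inCh → case InCh⇒primitive {q} inCh of λ where
    (a , b , c , prim , cos) →
      a , b , c , prim , primitive-flip {a} {b} {c} prim , primitive⇒a≢b∸a {a} {b} {c} prim ∘ cong proj₁ ,
      cos , CosEq-flip {q} {a} {b} {c} (proj₁ (proj₂ prim)) cos ,
      λ a′ b′ c′ prim′ cos′ → ∣δ∣-proportional⇒≡⊎≡flip {a} {b} {c} {a′} {b′} {c′} prim prim′
                                (CosEq⇒∣δ∣-proportional {q} {a} {b} {c} {a′} {b′} {c′} cos cos′))
  ,
  (λ a b c prim → case primitive⇒InCh prim of λ where
    (q , inCh , cos) → q , (inCh , cos) , λ q′ _ cos′ → CosEq-unique {q′} {q} {a} {b} {c} (eisenstein⇒c≢0 {a} {b} {c} (proj₁ prim)) cos′ cos)
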